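{- Let $G$ be a cyclic group of order $n=2^m l$ with $m\ge 1$ and $l>1$ odd, and let $\{A,B,C\}$ be a rainbow-free $3$-coloring of $G$ with non-empty color classes. Let $P_0=2\cdot G$ (a subgroup of index $2$) and let $P_1=G\setminus P_0$ be its other coset. Then neither $P_0$ nor $P_1$ is monochromatic (i.e. neither is contained in a single color class).
   Context: A $3$-term arithmetic progression is a triple $(x,y,z)\in G^3$ with $x+y=2z$; it is rainbow if its members lie in pairwise distinct color classes; a coloring is rainbow-free if there is none. $2\cdot G=\{2x:x\in G\}$. -}

module Defs where

open import Data.Nat using (ℕ; _+_; NonZero)
open import Data.Nat.DivMod using (_mod_)
open import Data.Fin using (Fin; toℕ)
open import Data.Product using (Σ; ∃; _×_; _,_)
open import Relation.Binary.PropositionalEquality using (_≡_; _≢_)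
open import Relation.Nullary using (¬_)

module Cyclic (n : ℕ) .{{_ : NonZero n}} where

  G : Set
  G = Fin n

  _⊕_ : G → G → G
  x ⊕ y = (toℕ x + toℕ y) mod n

  dbl : G → G
  dbl x = x ⊕ x

  In2G : G → Set
  In2G g = ∃ λ x → dbl x ≡ g

  Coloring : Set
  Coloring = G → Fin 3

  NonEmptyClasses : Coloring → Set
  NonEmptyClasses c = (k : Fin 3) → ∃ λ g → c g ≡ k

  Rainbow3AP : Coloring → G → G → G → Set
  Rainbow3AP c x y z =
    (x ⊕ y ≡ dbl z) × (c x ≢ c y) × (c x ≢ c z) × (c y ≢ c z)

  RainbowFree : Coloring → Set
  RainbowFree c = ∀ x y z → ¬ Rainbow3AP c x y z

  Monochromatic : Coloring → (G → Set) → Set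
  Monochromatic c P = ∃ λ k → ∀ g → P g → c g ≡ k

  P₀ : G → Set
  P₀ = In2G

  P₁ : G → Set
  P₁ g = ¬ In2G g

-- Take distinct colours p, q and points b, c of these colours with
-- c = b + 2h. The midpoint z = b + h satisfies b + c = 2z, so rainbow-freeness
-- forces z to have colour p or q, which gives a p–q pair at offset h. Halving
-- repeatedly yields a p–q pair at odd offset; since n is even, its two points
-- lie in different cosets of 2·G. Hence each coset meets the union of any two
-- colour classes, and so cannot lie inside the third.
module Submission where

open import Defs
open import Data.Nat using (ℕ; _^_; _*_; _≥_; _>_; NonZero)
open import Data.Nat.Divisibility using (_∣_)
open import Data.Product using (_×_)
open import Relation.Binary.PropositionalEquality using (_≡_)
open import Relation.Nullary using (¬_)

open import Data.Nat using (zero; suc; _+_; _∸_; _<_; _%_; s≤s; z≤n)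
open import Data.Nat.Properties using (+-assoc; +-suc; +-identityʳ; m+[n∸m]≡n; <⇒≤; m<m*n)
open import Data.Nat.DivMod
  using (_mod_; %-distribˡ-+; m<n⇒m%n≡m; [m+kn]%n≡m%n; m*n%n≡0; %-remove-+ˡ; m∣n⇒o%n%m≡o%m)
open import Data.Nat.Divisibility using (∣-refl; ∣-trans; m∣m*n)
open import Data.Nat.Induction using (<-rec)
open import Data.Nat.Tactic.RingSolver using (solve-∀)
open import Data.Fin using (Fin; toℕ; zero; suc)
open import Data.Fin.Properties using (toℕ-fromℕ<; toℕ-injective; toℕ<n; _≟_)
open import Data.Product using (∃; ∃₂; _,_; proj₁; proj₂)
open import Data.Sum using (_⊎_; inj₁; inj₂)
open import Data.Empty using (⊥-elim)
open import Relation.Nullary using (Dec; yes; no)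
open import Relation.Binary.PropositionalEquality using (_≢_; refl; sym; trans; cong; cong₂; subst; module ≡-Reasoning)

open ≡-Reasoning

data Parity (d : ℕ) : Set where
  even : ∀ h → d ≡ h * 2 → Parity d
  odd  : ∀ h → d ≡ 1 + h * 2 → Parity d

parity : ∀ d → Parity d
parity zero          = even 0 refl
parity (suc zero)    = odd 0 refl
parity (suc (suc d)) with parity d
... | even h d≡2h   = even (suc h) (cong (2 +_) d≡2h)
... | odd h d≡1+2h  = odd (suc h) (cong (2 +_) d≡1+2h)

≡*2⇒%2≡0 : ∀ {d} h → d ≡ h * 2 → d % 2 ≡ 0
≡*2⇒%2≡0 h refl = m*n%n≡0 h 2

≡1+*2⇒%2≡1 : ∀ {d} h → d ≡ 1 + h * 2 → d % 2 ≡ 1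
≡1+*2⇒%2≡1 h refl = [m+kn]%n≡m%n 1 h 2

m+m≡m*2 : ∀ m → m + m ≡ m * 2
m+m≡m*2 = solve-∀

otherColours : (k : Fin 3) → ∃₂ λ p q → p ≢ q × p ≢ k × q ≢ k
otherColours zero             = suc zero , suc (suc zero) , (λ ()) , (λ ()) , (λ ())
otherColours (suc zero)       = zero , suc (suc zero) , (λ ()) , (λ ()) , (λ ())
otherColours (suc (suc zero)) = zero , suc zero , (λ ()) , (λ ()) , (λ ())

2∣2^m*l : ∀ {m} l → m ≥ 1 → 2 ∣ 2 ^ m * l
2∣2^m*l {suc m} l _ = ∣-trans (m∣m*n (2 ^ m)) (m∣m*n l)

module _ {n : ℕ} .{{_ : NonZero n}} where
  open Cyclic n

  toℕ-mod : ∀ a → toℕ (a mod n) ≡ a % n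
  toℕ-mod a = toℕ-fromℕ< _

  mod-cong : ∀ {a b} → a % n ≡ b % n → a mod n ≡ b mod n
  mod-cong {a} {b} eq = toℕ-injective (trans (toℕ-mod a) (trans eq (sym (toℕ-mod b))))

  mod-toℕ : ∀ g → toℕ g mod n ≡ g
  mod-toℕ g = toℕ-injective (trans (toℕ-mod (toℕ g)) (m<n⇒m%n≡m (toℕ<n g)))

  mod-⊕ : ∀ a b → (a mod n) ⊕ (b mod n) ≡ (a + b) mod n
  mod-⊕ a b = mod-cong (begin
    (toℕ (a mod n) + toℕ (b mod n)) % n ≡⟨ cong₂ (λ x y → (x + y) % n) (toℕ-mod a) (toℕ-mod b) ⟩
    (a % n + b % n) % n                 ≡⟨ %-distribˡ-+ a b n ⟨
    (a + b) % n                         ∎)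

  ⊕-mod : ∀ g a → g ⊕ (a mod n) ≡ (toℕ g + a) mod n
  ⊕-mod g a = trans (cong (_⊕ (a mod n)) (sym (mod-toℕ g))) (mod-⊕ (toℕ g) a)

  ⊕-mod-assoc : ∀ g a b → (g ⊕ (a mod n)) ⊕ (b mod n) ≡ g ⊕ ((a + b) mod n)
  ⊕-mod-assoc g a b = begin
    (g ⊕ (a mod n)) ⊕ (b mod n)   ≡⟨ cong (_⊕ (b mod n)) (⊕-mod g a) ⟩
    ((toℕ g + a) mod n) ⊕ (b mod n) ≡⟨ mod-⊕ (toℕ g + a) b ⟩
    (toℕ g + a + b) mod n         ≡⟨ cong (_mod n) (+-assoc (toℕ g) a b) ⟩
    (toℕ g + (a + b)) mod n       ≡⟨ ⊕-mod g (a + b) ⟨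
    g ⊕ ((a + b) mod n)           ∎

  ⊕-mod-zero : ∀ g → g ⊕ (0 mod n) ≡ g
  ⊕-mod-zero g = trans (⊕-mod g 0) (trans (cong (_mod n) (+-identityʳ (toℕ g))) (mod-toℕ g))

  offset : ∀ b c → ∃ λ d → b ⊕ (d mod n) ≡ c
  offset b c = n ∸ B + C , (begin
    b ⊕ ((n ∸ B + C) mod n)   ≡⟨ ⊕-mod b (n ∸ B + C) ⟩
    (B + (n ∸ B + C)) mod n   ≡⟨ cong (_mod n) (+-assoc B (n ∸ B) C) ⟨
    (B + (n ∸ B) + C) mod n   ≡⟨ cong (λ x → (x + C) mod n) (m+[n∸m]≡n (<⇒≤ (toℕ<n b))) ⟩
    (n + C) mod n             ≡⟨ mod-cong (%-remove-+ˡ C ∣-refl) ⟩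
    C mod n                   ≡⟨ mod-toℕ c ⟩
    c                         ∎)
    where
    B = toℕ b
    C = toℕ c

  midpoint : ∀ b h → b ⊕ (b ⊕ ((h * 2) mod n)) ≡ dbl (b ⊕ (h mod n))
  midpoint b h = begin
    b ⊕ (b ⊕ ((h * 2) mod n))           ≡⟨ cong (b ⊕_) (⊕-mod b (h * 2)) ⟩
    b ⊕ ((B + h * 2) mod n)             ≡⟨ ⊕-mod b (B + h * 2) ⟩
    (B + (B + h * 2)) mod n             ≡⟨ cong (_mod n) (x+[x+y*2]≡[x+y]+[x+y] B h) ⟩
    (B + h + (B + h)) mod n             ≡⟨ mod-⊕ (B + h) (B + h) ⟨
    dbl ((B + h) mod n)                 ≡⟨ cong dbl (⊕-mod b h) ⟨
    dbl (b ⊕ (h mod n))                 ∎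
    where
    B = toℕ b
    x+[x+y*2]≡[x+y]+[x+y] : ∀ x y → x + (x + y * 2) ≡ x + y + (x + y)
    x+[x+y*2]≡[x+y]+[x+y] = solve-∀

  module _ (col : Coloring) where

    Link : Fin 3 → Fin 3 → ℕ → Set
    Link p q d = ∃₂ λ b c → col b ≡ p × col c ≡ q × b ⊕ (d mod n) ≡ c

    link : ∀ {p q} → (∃ λ b → col b ≡ p) → (∃ λ c → col c ≡ q) → ∃ (Link p q)
    link (b , b↦p) (c , c↦q) with offset b c
    ... | d , b+d≡c = d , b , c , b↦p , c↦q , b+d≡c

    link-zero⇒≡ : ∀ {p q} → Link p q 0 → p ≡ q
    link-zero⇒≡ (b , c , b↦p , c↦q , b+0≡c) =
      trans (sym b↦p) (trans (cong col (trans (sym (⊕-mod-zero b)) b+0≡c)) c↦q)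

    Meets : (G → Set) → Fin 3 → Fin 3 → Set
    Meets P p q = ∃ λ g → P g × (col g ≡ p ⊎ col g ≡ q)

    ¬monochromatic : ∀ {P} → (∀ {p q} → p ≢ q → Meets P p q) → ¬ Monochromatic col P
    ¬monochromatic meets (k , P⊆k) with otherColours k
    ... | p , q , p≢q , p≢k , q≢k with meets p≢q
    ...   | g , Pg , inj₁ g↦p = p≢k (trans (sym g↦p) (P⊆k g Pg))
    ...   | g , Pg , inj₂ g↦q = q≢k (trans (sym g↦q) (P⊆k g Pg))

    module _ (rainbowFree : RainbowFree col) where

      halve : ∀ {p q h} → p ≢ q → Link p q (h * 2) → Link p q h
      halve {p} {q} {h} p≢q (b , c , b↦p , c↦q , b+2h≡c) = split (col z ≟ p) (col z ≟ q)
        where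
        z : G
        z = b ⊕ (h mod n)

        z+h≡c : z ⊕ (h mod n) ≡ c
        z+h≡c = trans (⊕-mod-assoc b h h) (trans (cong (λ d → b ⊕ (d mod n)) (m+m≡m*2 h)) b+2h≡c)

        b+c≡2z : b ⊕ c ≡ dbl z
        b+c≡2z = trans (cong (b ⊕_) (sym b+2h≡c)) (midpoint b h)

        split : Dec (col z ≡ p) → Dec (col z ≡ q) → Link p q h
        split (yes z↦p) _          = z , c , z↦p , c↦q , z+h≡c
        split (no _)    (yes z↦q)  = b , z , b↦p , z↦q , refl
        split (no ¬z↦p) (no ¬z↦q) = ⊥-elim (rainbowFree b c z
          ( b+c≡2z
          , (λ e → p≢q (trans (sym b↦p) (trans e c↦q)))
          , (λ e → ¬z↦p (trans (sym e) b↦p))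
          , (λ e → ¬z↦q (trans (sym e) c↦q))))

      link-at-odd-offset : ∀ {p q} → p ≢ q → ∀ d → Link p q d → ∃ λ h → Link p q (1 + h * 2)
      link-at-odd-offset {p} {q} p≢q = <-rec _ step
        where
        step : ∀ d → (∀ {d′} → d′ < d → Link p q d′ → ∃ λ h → Link p q (1 + h * 2)) →
               Link p q d → ∃ λ h → Link p q (1 + h * 2)
        step d rec l with parity d
        ... | odd h refl        = h , l
        ... | even zero refl    = ⊥-elim (p≢q (link-zero⇒≡ l))
        ... | even (suc h) refl = rec (m<m*n (suc h) 2 (s≤s (s≤s z≤n))) (halve p≢q l)

  module _ (2∣n : 2 ∣ n) where

    toℕ-mod-%2 : ∀ a → toℕ (a mod n) % 2 ≡ a % 2
    toℕ-mod-%2 a = trans (cong (_% 2) (toℕ-mod a)) (m∣n⇒o%n%m≡o%m 2 n a 2∣n)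

    In2G⇒even : ∀ {g} → In2G g → toℕ g % 2 ≡ 0
    In2G⇒even (x , refl) = begin
      toℕ (dbl x) % 2   ≡⟨ toℕ-mod-%2 (X + X) ⟩
      (X + X) % 2       ≡⟨ cong (_% 2) (m+m≡m*2 X) ⟩
      (X * 2) % 2       ≡⟨ m*n%n≡0 X 2 ⟩
      0                 ∎
      where
      X = toℕ x

    odd⇒∉2G : ∀ {g} → toℕ g % 2 ≡ 1 → ¬ In2G g
    odd⇒∉2G g%2≡1 g∈2G with trans (sym g%2≡1) (In2G⇒even g∈2G)
    ... | ()

    even⇒In2G : ∀ {g} → toℕ g % 2 ≡ 0 → In2G g
    even⇒In2G {g} g%2≡0 with parity (toℕ g)
    ... | even h g≡2h = h mod n , (begin
      dbl (h mod n)       ≡⟨ mod-⊕ h h ⟩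
      (h + h) mod n       ≡⟨ cong (_mod n) (m+m≡m*2 h) ⟩
      (h * 2) mod n       ≡⟨ cong (_mod n) g≡2h ⟨
      toℕ g mod n         ≡⟨ mod-toℕ g ⟩
      g                   ∎)
    ... | odd h g≡1+2h with trans (sym g%2≡0) (≡1+*2⇒%2≡1 h g≡1+2h)
    ...   | ()

    odd-offset-%2 : ∀ b h → toℕ (b ⊕ ((1 + h * 2) mod n)) % 2 ≡ suc (toℕ b) % 2
    odd-offset-%2 b h = begin
      toℕ (b ⊕ ((1 + h * 2) mod n)) % 2   ≡⟨ cong (λ g → toℕ g % 2) (⊕-mod b (1 + h * 2)) ⟩
      toℕ ((B + suc (h * 2)) mod n) % 2   ≡⟨ toℕ-mod-%2 (B + suc (h * 2)) ⟩
      (B + suc (h * 2)) % 2               ≡⟨ cong (_% 2) (+-suc B (h * 2)) ⟩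
      (suc B + h * 2) % 2                 ≡⟨ [m+kn]%n≡m%n (suc B) h 2 ⟩
      suc B % 2                           ∎
      where
      B = toℕ b

    cosetsMeet : ∀ col → RainbowFree col → NonEmptyClasses col →
                 ∀ {p q} → p ≢ q → Meets col P₀ p q × Meets col P₁ p q
    cosetsMeet col rainbowFree nonEmpty {p} {q} p≢q
      with link-at-odd-offset col rainbowFree p≢q _ (proj₂ (link col (nonEmpty p) (nonEmpty q)))
    ... | h , b , c , b↦p , c↦q , b+d≡c = split (parity (toℕ b))
      where
      c%2≡suc-b%2 : toℕ c % 2 ≡ suc (toℕ b) % 2
      c%2≡suc-b%2 = trans (cong (λ g → toℕ g % 2) (sym b+d≡c)) (odd-offset-%2 b h)

      split : Parity (toℕ b) → Meets col P₀ p q × Meets col P₁ p q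
      split (even k b≡2k)  = (b , even⇒In2G (≡*2⇒%2≡0 k b≡2k) , inj₁ b↦p)
                           , (c , odd⇒∉2G (trans c%2≡suc-b%2 (≡1+*2⇒%2≡1 k (cong suc b≡2k))) , inj₂ c↦q)
      split (odd k b≡1+2k) = (c , even⇒In2G (trans c%2≡suc-b%2 (≡*2⇒%2≡0 (suc k) (cong suc b≡1+2k))) , inj₂ c↦q)
                           , (b , odd⇒∉2G (≡1+*2⇒%2≡1 k b≡1+2k) , inj₁ b↦p)

lemma13 : (n m l : ℕ) .{{_ : NonZero n}} → n ≡ 2 ^ m * l → m ≥ 1 → l > 1 → ¬ (2 ∣ l) →
          (c : Cyclic.Coloring n) → Cyclic.NonEmptyClasses n c → Cyclic.RainbowFree n c →
          ¬ Cyclic.Monochromatic n c (Cyclic.P₀ n) × ¬ Cyclic.Monochromatic n c (Cyclic.P₁ n)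
lemma13 n m l n≡2^m*l m≥1 _ _ col nonEmpty rainbowFree =
  ¬monochromatic col (λ p≢q → proj₁ (meets p≢q)) , ¬monochromatic col (λ p≢q → proj₂ (meets p≢q))
  where
  2∣n : 2 ∣ n
  2∣n = subst (2 ∣_) (sym n≡2^m*l) (2∣2^m*l l m≥1)

  meets : ∀ {p q} → p ≢ q → Meets col (Cyclic.P₀ n) p q × Meets col (Cyclic.P₁ n) p q
  meets = cosetsMeet 2∣n col rainbowFree nonEmpty
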